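{- For every $n\ge 1$, the path $P_n$ on $n$ vertices satisfies $\gamma^{p}_{I}(P_n)=\left\lceil\frac{n+1}{2}\right\rceil$.
   Context: All graphs are finite and simple. A perfect Italian dominating function (PID-function) of a graph $G$ is a function $f:V(G)\to\{0,1,2\}$ such that for every vertex $v$ with $f(v)=0$ we have $\sum_{u\in N(v)}f(u)=2$, where $N(v)$ is the open neighborhood of $v$. Its weight is $\sum_{u\in V(G)}f(u)$. The perfect Italian domination number $\gamma^{p}_{I}(G)$ is the minimum weight of a PID-function of $G$. -}

module Defs where

open import Data.Nat using (ℕ; zero; suc; _+_; _≤_; _≡ᵇ_)
open import Data.Fin using (Fin; toℕ)
open import Data.Bool using (Bool; true; false; if_then_else_; _∨_)
open import Data.Bool.Properties using (∨-comm)
open import Data.Vec.Functional using (foldr)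
open import Data.Product using (Σ; _×_; _,_)
open import Relation.Binary.PropositionalEquality using (_≡_)

record Graph (n : ℕ) : Set where
  field
    adj   : Fin n → Fin n → Bool
    sym   : ∀ i j → adj i j ≡ adj j i
    irrefl : ∀ i → adj i i ≡ false
open Graph public

sumFin : ∀ {n} → (Fin n → ℕ) → ℕ
sumFin {n} g = foldr _+_ 0 g

Labeling : ℕ → Set
Labeling n = Fin n → Fin 3

weight : ∀ {n} → Labeling n → ℕ
weight f = sumFin (λ v → toℕ (f v))

nbSum : ∀ {n} → Graph n → Labeling n → Fin n → ℕ
nbSum G f v = sumFin (λ u → if adj G v u then toℕ (f u) else 0)

IsPID : ∀ {n} → Graph n → Labeling n → Set
IsPID G f = ∀ v → toℕ (f v) ≡ 0 → nbSum G f v ≡ 2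

IsPIDNumber : ∀ {n} → Graph n → ℕ → Set
IsPIDNumber G k =
  Σ (Labeling _) (λ f → IsPID G f × weight f ≡ k)
  × (∀ f → IsPID G f → k ≤ weight f)

pathAdjℕ : ℕ → ℕ → Bool
pathAdjℕ i j = (suc i ≡ᵇ j) ∨ (suc j ≡ᵇ i)

pathAdjℕ-sym : ∀ i j → pathAdjℕ i j ≡ pathAdjℕ j i
pathAdjℕ-sym i j = ∨-comm (suc i ≡ᵇ j) (suc j ≡ᵇ i)

sucᵇ : ∀ i → (suc i ≡ᵇ i) ≡ false
sucᵇ zero = _≡_.refl
sucᵇ (suc i) = sucᵇ i

pathAdjℕ-irrefl : ∀ i → pathAdjℕ i i ≡ false
pathAdjℕ-irrefl i rewrite sucᵇ i = _≡_.refl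

Path : (n : ℕ) → Graph n
Path n = record
  { adj = λ i j → pathAdjℕ (toℕ i) (toℕ j)
  ; sym = λ i j → pathAdjℕ-sym (toℕ i) (toℕ j)
  ; irrefl = λ i → pathAdjℕ-irrefl (toℕ i)
  }

module Submission where

-- We work with ℕ-valued labellings h of the path on Fin m and call h
-- perfect after a boundary value c when, in the path c, h 0, h 1, …,
-- every vertex of h labelled 0 has neighbour sum 2 (the boundary vertex
-- itself is unconstrained).  Removing the first vertex turns a labelling
-- perfect after c into one perfect after the removed label, and the
-- boundary is irrelevant when the first label is nonzero.
--
-- Lower bound: every perfect labelling on m vertices satisfies
-- m + (first label) ≤ 2·weight.  Induct by removing the first vertex when
-- the second label is nonzero, and the first two vertices when the second
-- label is 0 (then the first and third labels sum to 2).  A separate look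
-- at a first label 0 (which forces the second label to be 2) then gives
-- n + 1 ≤ 2·weight for every PID-function of P_n.
--
-- Upper bound: the labelling 1 0 1 0 … 1 (odd n), 1 0 … 1 0 1 1 (even n)
-- is a PID-function of weight ⌊(n+2)/2⌋.

open import Defs hiding (sym)
open import Data.Nat using (ℕ; zero; suc; _+_; _*_; _≤_; _/_; s≤s; s≤s⁻¹; z≤n; _≟_)
open import Data.Nat.Properties
  using (≤-trans; +-identityʳ; ≤-reflexive; +-comm; +-suc; +-monoˡ-≤; +-monoʳ-≤; *-comm;
         *-monoʳ-≤; m≤m+n; m≤n+m; n≢0⇒n>0; n<1+n; module ≤-Reasoning)
open import Data.Nat.DivMod using (m<n*o⇒m/o<n; m/n≡1+[m∸n]/n)
open import Data.Nat.Tactic.RingSolver using (solve-∀)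
open import Data.Fin using (Fin; zero; suc; toℕ)
open import Data.Vec.Functional using ([]; _∷_; head; tail)
open import Data.Bool using (if_then_else_)
open import Data.Product using (_,_)
open import Relation.Binary.PropositionalEquality
  using (_≡_; _≢_; refl; sym; trans; cong; subst; module ≡-Reasoning)
open import Relation.Nullary using (yes; no; contradiction)

pathNbSum : ∀ {m} → (Fin m → ℕ) → Fin m → ℕ
pathNbSum h v = sumFin (λ u → if pathAdjℕ (toℕ v) (toℕ u) then h u else 0)

PerfectAfter : ∀ {m} → ℕ → (Fin m → ℕ) → Set
PerfectAfter c h = ∀ v → h v ≡ 0 → pathNbSum (c ∷ h) (suc v) ≡ 2

Perfect : ∀ {m} → (Fin m → ℕ) → Set
Perfect = PerfectAfter 0

headOr0 : ∀ {m} → (Fin m → ℕ) → ℕ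
headOr0 {zero}  h = 0
headOr0 {suc m} h = head h

pid⇒perfect : ∀ {n} (f : Labeling n) → IsPID (Path n) f → Perfect (λ v → toℕ (f v))
pid⇒perfect f isPID zero    = isPID zero
pid⇒perfect f isPID (suc v) = isPID (suc v)

perfect⇒pid : ∀ {n} (f : Labeling n) → Perfect (λ v → toℕ (f v)) → IsPID (Path n) f
perfect⇒pid f perfect zero    = perfect zero
perfect⇒pid f perfect (suc v) = perfect (suc v)

sumFin-zero : ∀ m → sumFin {m} (λ _ → 0) ≡ 0
sumFin-zero zero    = refl
sumFin-zero (suc m) = sumFin-zero m

first-vertex-nbSum : ∀ {m} c (h : Fin (suc m) → ℕ) →
                     pathNbSum (c ∷ h) (suc zero) ≡ c + headOr0 (tail h)
first-vertex-nbSum {zero}  c h = refl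
first-vertex-nbSum {suc m} c h =
  cong (c +_) (trans (cong (h (suc zero) +_) (sumFin-zero m)) (+-identityʳ _))

perfectAfter-first : ∀ {m c} {h : Fin (suc m) → ℕ} →
                     PerfectAfter c h → head h ≡ 0 → c + headOr0 (tail h) ≡ 2
perfectAfter-first {c = c} {h} perfect h₀≡0 =
  trans (sym (first-vertex-nbSum c h)) (perfect zero h₀≡0)

perfectAfter-tail : ∀ {m c} {h : Fin (suc m) → ℕ} →
                    PerfectAfter c h → PerfectAfter (head h) (tail h)
perfectAfter-tail perfect v = perfect (suc v)

perfectAfter-cons : ∀ {m c} {h : Fin (suc m) → ℕ} →
                    (head h ≡ 0 → c + headOr0 (tail h) ≡ 2) →
                    PerfectAfter (head h) (tail h) → PerfectAfter c h
perfectAfter-cons {c = c} {h} first rest zero    h₀≡0 =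
  trans (first-vertex-nbSum c h) (first h₀≡0)
perfectAfter-cons                first rest (suc v)    = rest v

-- The boundary only matters through the first vertex, so it can be
-- changed freely when the first label is nonzero.
perfectAfter-rebound : ∀ {m c c′} {h : Fin (suc m) → ℕ} →
                       PerfectAfter c h → head h ≢ 0 → PerfectAfter c′ h
perfectAfter-rebound perfect h₀≢0 =
  perfectAfter-cons (λ h₀≡0 → contradiction h₀≡0 h₀≢0) (perfectAfter-tail perfect)

-- The arithmetic of one induction step: prepending a vertex of label y
-- (and possibly a vertex of label 0) to a labelling with a + x ≤ 2s
-- adds d vertices, where d ≤ x + y.
extend-bound : ∀ {a d s x y} → a + x ≤ 2 * s → d ≤ x + y → d + a + y ≤ 2 * (y + s)
extend-bound {a} {d} {s} {x} {y} a+x≤2s d≤x+y = begin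
  d + a + y           ≤⟨ +-monoˡ-≤ y (+-monoˡ-≤ a d≤x+y) ⟩
  x + y + a + y       ≡⟨ regroup a x y ⟩
  (a + x) + 2 * y     ≤⟨ +-monoˡ-≤ (2 * y) a+x≤2s ⟩
  2 * s + 2 * y       ≡⟨ distrib s y ⟩
  2 * (y + s)         ∎
  where
  open ≤-Reasoning
  regroup : ∀ a x y → x + y + a + y ≡ (a + x) + 2 * y
  regroup = solve-∀
  distrib : ∀ s y → 2 * s + 2 * y ≡ 2 * (y + s)
  distrib = solve-∀

-- One induction step for the main estimate below, given the estimate for
-- the paths obtained by removing one and two vertices: remove one vertex
-- when the second label is nonzero (the first vertex no longer matters to
-- the rest); remove two when it is 0 (then h 0 + h 2 = 2).
perfect-weight-step :
  ∀ k (h : Fin (suc (suc k)) → ℕ) → Perfect h →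
  (Perfect (tail h) → suc k + head (tail h) ≤ 2 * sumFin (tail h)) →
  (Perfect (tail (tail h)) → k + headOr0 (tail (tail h)) ≤ 2 * sumFin (tail (tail h))) →
  suc (suc k) + head h ≤ 2 * sumFin h
perfect-weight-step k h perfect drop-one drop-two with h (suc zero) ≟ 0
... | no h₁≢0 =
  extend-bound {y = head h}
    (drop-one (perfectAfter-rebound (perfectAfter-tail perfect) h₁≢0))
    (≤-trans (n≢0⇒n>0 h₁≢0) (m≤m+n _ _))
... | yes h₁≡0 =
  extend-bound {y = head h}
    (≤-trans (drop-two tail²-perfect) (*-monoʳ-≤ 2 (m≤n+m _ (h (suc zero)))))
    (≤-reflexive (sym (trans (+-comm _ (head h)) second-satisfied)))
  where
  tail²-perfect : Perfect (tail (tail h))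
  tail²-perfect = subst (λ c → PerfectAfter c (tail (tail h))) h₁≡0
                        (perfectAfter-tail (perfectAfter-tail perfect))
  second-satisfied : head h + headOr0 (tail (tail h)) ≡ 2
  second-satisfied = perfectAfter-first (perfectAfter-tail perfect) h₁≡0

perfect-weight : ∀ m (h : Fin m → ℕ) → Perfect h → m + headOr0 h ≤ 2 * sumFin h
perfect-weight zero          h perfect = z≤n
perfect-weight (suc zero)    h perfect = extend-bound {a = 0} {s = 0} {x = 0} z≤n (n≢0⇒n>0 h₀≢0)
  where
  -- a single vertex has no neighbours, so it cannot be labelled 0
  h₀≢0 : head h ≢ 0
  h₀≢0 h₀≡0 with perfectAfter-first perfect h₀≡0
  ... | ()
perfect-weight (suc (suc k)) h perfect =
  perfect-weight-step k h perfect (perfect-weight (suc k) (tail h)) (perfect-weight k (tail (tail h)))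

perfect-lower : ∀ m (h : Fin (suc m) → ℕ) → Perfect h → suc m + 1 ≤ 2 * sumFin h
perfect-lower m h perfect with head h ≟ 0
... | no h₀≢0 = ≤-trans (+-monoʳ-≤ (suc m) (n≢0⇒n>0 h₀≢0)) (perfect-weight (suc m) h perfect)
... | yes h₀≡0 = begin
  suc m + 1                 ≡⟨ sym (+-suc m 1) ⟩
  m + 2                     ≡⟨ cong (m +_) (sym second≡2) ⟩
  m + headOr0 (tail h)      ≤⟨ perfect-weight m (tail h) tail-perfect ⟩
  2 * sumFin (tail h)       ≤⟨ *-monoʳ-≤ 2 (m≤n+m _ (head h)) ⟩
  2 * sumFin h              ∎
  where
  open ≤-Reasoning
  -- a first vertex labelled 0 needs its only neighbour to carry 2
  second≡2 : headOr0 (tail h) ≡ 2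
  second≡2 = perfectAfter-first perfect h₀≡0
  tail-perfect : Perfect (tail h)
  tail-perfect = subst (λ c → PerfectAfter c (tail h)) h₀≡0 (perfectAfter-tail perfect)

half-lower : ∀ {N w} → N + 1 ≤ 2 * w → (N + 2) / 2 ≤ w
half-lower {N} {w} N+1≤2w = s≤s⁻¹ (m<n*o⇒m/o<n {N + 2} {suc w} {2} (begin-strict
  N + 2           ≡⟨ +-suc N 1 ⟩
  suc (N + 1)     ≤⟨ s≤s N+1≤2w ⟩
  suc (2 * w)     <⟨ n<1+n _ ⟩
  2 + 2 * w       ≡⟨ cong (2 +_) (*-comm 2 w) ⟩
  suc w * 2       ∎))
  where open ≤-Reasoning

optimal : ∀ m → Labeling (suc m)
optimal zero          = suc zero ∷ []
optimal (suc zero)    = suc zero ∷ suc zero ∷ []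
optimal (suc (suc m)) = suc zero ∷ zero ∷ optimal m

optimal-head : ∀ m → optimal m zero ≡ suc zero
optimal-head zero          = refl
optimal-head (suc zero)    = refl
optimal-head (suc (suc m)) = refl

-- Each 0 of the optimal labelling sits between two 1s.
optimal-perfect : ∀ m c → PerfectAfter c (λ v → toℕ (optimal m v))
optimal-perfect zero          c = perfectAfter-cons (λ ()) (λ ())
optimal-perfect (suc zero)    c = perfectAfter-cons (λ ()) (perfectAfter-cons (λ ()) (λ ()))
optimal-perfect (suc (suc m)) c =
  perfectAfter-cons (λ ())
    (perfectAfter-cons (λ _ → cong (λ x → suc (toℕ x)) (optimal-head m))
                       (optimal-perfect m 0))

optimal-weight : ∀ m → weight (optimal m) ≡ (suc m + 2) / 2
optimal-weight zero          = refl
optimal-weight (suc zero)    = refl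
optimal-weight (suc (suc m)) = begin
  suc (weight (optimal m))  ≡⟨ cong suc (optimal-weight m) ⟩
  suc ((suc m + 2) / 2)     ≡⟨ sym (m/n≡1+[m∸n]/n {suc (suc (suc m + 2))} {2} (s≤s (s≤s z≤n))) ⟩
  (suc (suc (suc m)) + 2) / 2  ∎
  where open ≡-Reasoning

theorem2p3 : (n : ℕ) → 1 ≤ n → IsPIDNumber (Path n) ((n + 2) / 2)
theorem2p3 (suc m) _ =
    (optimal m , perfect⇒pid (optimal m) (optimal-perfect m 0) , optimal-weight m)
  , λ f isPID → half-lower {suc m} (perfect-lower m _ (pid⇒perfect f isPID))
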